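{- Let $f(x,y)=\sum_{i,j=-\infty}^{\infty}\lambda(i,j)x^iy^j$ be a nonzero formal bilateral series with complex coefficients. Then $f\perp f$ if and only if there exist integers $m_0,k_0$ and complex sequences $\{p_i\}_{i\in\mathbb{Z}}$, $\{q_i\}_{i\in\mathbb{Z}}$ with $p_{m_0}=0$, $q_{k_0}=0$ and $p_{k_0}=-q_{m_0}\neq 0$, such that $$f(x,y)=P(x)Q(y)-P(y)Q(x),$$ where $P(x)=\sum_{i=-\infty}^{\infty}p_ix^i$ and $Q(x)=\frac{1}{q_{m_0}}\sum_{i=-\infty}^{\infty}q_ix^i$.
   Context: A formal bilateral series in $x,y$ is an expression $\sum_{i,j\in\mathbb{Z}}\lambda(i,j)x^iy^j$ with arbitrary complex coefficients. For two such series $f,g$, we say $f$ is orthogonal to $g$, written $f\perp g$, if $$g(a,b)f(x,c)-g(a,c)f(x,b)+g(b,c)f(x,a)=0$$ identically in the four independent variables $a,b,c,x$. $f$ is self-orthogonal if $f\perp f$; equivalently, $\lambda(m,i)\lambda(k,j)-\lambda(k,i)\lambda(m,j)+\lambda(k,m)\lambda(i,j)=0$ for all integers $m,i,j,k$. -}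

module Defs where

open import Level using (Level; _⊔_) renaming (suc to lsuc)
open import Algebra.Bundles using (CommutativeRing)
open import Data.Integer using (ℤ)
open import Data.Product using (Σ; ∃)
open import Relation.Nullary using (¬_)

record Field (c ℓ : Level) : Set (lsuc (c ⊔ ℓ)) where
  field
    commutativeRing : CommutativeRing c ℓ
  open CommutativeRing commutativeRing public
  field
    0≉1 : ¬ (0# ≈ 1#)
    inverse : (x : Carrier) → ¬ (x ≈ 0#) → Σ Carrier (λ y → x * y ≈ 1#)

  inv : (x : Carrier) → ¬ (x ≈ 0#) → Carrier
  inv x nz = Σ.proj₁ (inverse x nz)

module _ {c ℓ : Level} (K : Field c ℓ) where
  open Field K

  Series1 : Set c
  Series1 = ℤ → Carrier

  -- a formal bilateral series in x,y: f = Σ λ(i,j) x^i y^j, given by λ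
  Series2 : Set c
  Series2 = ℤ → ℤ → Carrier

  NonzeroSeries : Series2 → Set ℓ
  NonzeroSeries f = ∃ λ i → ∃ λ j → ¬ (f i j ≈ 0#)

  -- f ⊥ f, in the coefficient form given in the paper
  SelfOrthogonal : Series2 → Set ℓ
  SelfOrthogonal λ' = ∀ m i j k →
    ((λ' m i * λ' k j) - (λ' k i * λ' m j)) + (λ' k m * λ' i j) ≈ 0#

  scale : Carrier → Series1 → Series1
  scale a P i = a * P i

  wedge : Series1 → Series1 → Series2
  wedge P Q i j = (P i * Q j) - (P j * Q i)

-- If f ⊥ f and λ(a,b) ≠ 0, the relation at (m,i,j,k) = (a,i,j,b) reads
-- λ(a,i)λ(b,j) - λ(a,j)λ(b,i) = -λ(b,a)λ(i,j), so f is, up to the unit -λ(b,a),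
-- the wedge of its a-th and b-th rows.  The specialisations k = m and
-- (m,i,j,k) = (b,a,b,a) give λ(m,m) = 0 and λ(b,a) = -λ(a,b), which are the side
-- conditions on p = -λ(a,·) and q = -λ(b,·).  Conversely, for f = P ∧ Q the
-- relation is the three-term Plücker identity between 2 × 2 minors.
module Submission where

open import Defs
open import Level using (Level; 0ℓ; _⊔_)
open import Data.Integer using (ℤ)
open import Data.Product using (Σ; ∃; _×_; _,_; proj₂; swap)
open import Data.Nat as ℕ using (ℕ)
open import Data.Maybe using (just; nothing)
open import Relation.Nullary using (¬_; yes; no)
open import Relation.Binary.Definitions using (WeaklyDecidable)
open import Relation.Binary.PropositionalEquality using (_≡_; cong)
open import Function.Bundles using (_⇔_; mk⇔)
open import Algebra.Bundles using (CommutativeRing)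
open import Algebra.Bundles.Raw using (RawRing)
open import Algebra.Solver.Ring.AlmostCommutativeRing
  using (fromCommutativeRing; _-Raw-AlmostCommutative⟶_; Induced-equivalence)

-- The pair (m , n) stands for the integer m - n.  Algebra.Solver.Ring needs
-- coefficients with a decidable equality, which an arbitrary commutative ring
-- does not provide, so differences of naturals serve as coefficients.
ℕ²-rawRing : RawRing 0ℓ 0ℓ
ℕ²-rawRing = record
  { Carrier = ℕ × ℕ
  ; _≈_     = _≡_
  ; _+_     = λ (a , b) (c , d) → (a ℕ.+ c , b ℕ.+ d)
  ; _*_     = λ (a , b) (c , d) → (a ℕ.* c ℕ.+ b ℕ.* d , a ℕ.* d ℕ.+ b ℕ.* c)
  ; -_      = swap
  ; 0#      = (0 , 0)
  ; 1#      = (1 , 0)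
  }

module RingSolver {c ℓ} (R : CommutativeRing c ℓ) where
  open CommutativeRing R
  open import Algebra.Properties.Semiring.Mult semiring using (×-homo-1; ×-homo-+; ×1-homo-*)
    renaming (_×_ to _·_)
  open import Algebra.Properties.Ring ring using (-0#≈0#; x[y-z]≈xy-xz; [y-z]x≈yx-zx)
  open import Algebra.Properties.AbelianGroup +-abelianGroup using (⁻¹-∙-comm; ⁻¹-anti-homo‿-)
  open import Algebra.Properties.CommutativeSemigroup +-commutativeSemigroup using (interchange)
  open import Relation.Binary.Reasoning.Setoid setoid

  x+z-[y+w]≈[x-y]+[z-w] : ∀ x y z w → (x + z) - (y + w) ≈ (x - y) + (z - w)
  x+z-[y+w]≈[x-y]+[z-w] x y z w = begin
    (x + z) - (y + w)     ≈⟨ +-congˡ (⁻¹-∙-comm y w) ⟨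
    (x + z) + (- y + - w) ≈⟨ interchange x z (- y) (- w) ⟩
    (x - y) + (z - w)     ∎

  x+w-[y+w]≈x-y : ∀ x y w → (x + w) - (y + w) ≈ x - y
  x+w-[y+w]≈x-y x y w = begin
    (x + w) - (y + w) ≈⟨ x+z-[y+w]≈[x-y]+[z-w] x y w w ⟩
    (x - y) + (w - w) ≈⟨ +-congˡ (-‿inverseʳ w) ⟩
    (x - y) + 0#      ≈⟨ +-identityʳ (x - y) ⟩
    x - y             ∎

  x+w≈y+z⇒x-y≈z-w : ∀ {x y z w} → x + w ≈ y + z → x - y ≈ z - w
  x+w≈y+z⇒x-y≈z-w {x} {y} {z} {w} x+w≈y+z = begin
    x - y             ≈⟨ x+w-[y+w]≈x-y x y w ⟨
    (x + w) - (y + w) ≈⟨ +-cong (trans x+w≈y+z (+-comm y z)) (-‿cong (+-comm y w)) ⟩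
    (z + y) - (w + y) ≈⟨ x+w-[y+w]≈x-y z w y ⟩
    z - w             ∎

  [x-y][z-w]≈[xz+yw]-[xw+yz] : ∀ x y z w →
    (x - y) * (z - w) ≈ (x * z + y * w) - (x * w + y * z)
  [x-y][z-w]≈[xz+yw]-[xw+yz] x y z w = begin
    (x - y) * (z - w)                 ≈⟨ [y-z]x≈yx-zx (z - w) x y ⟩
    x * (z - w) - y * (z - w)         ≈⟨ +-cong (x[y-z]≈xy-xz x z w) (-‿cong (x[y-z]≈xy-xz y z w)) ⟩
    (x * z - x * w) - (y * z - y * w) ≈⟨ +-congˡ (⁻¹-anti-homo‿- (y * z) (y * w)) ⟩
    (x * z - x * w) + (y * w - y * z) ≈⟨ x+z-[y+w]≈[x-y]+[z-w] _ _ _ _ ⟨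
    (x * z + y * w) - (x * w + y * z) ∎

  ⟦_⟧ℕ² : ℕ × ℕ → Carrier
  ⟦ m , n ⟧ℕ² = m · 1# - n · 1#

  ×1-homo-+* : ∀ a b c d →
    (a ℕ.* c ℕ.+ b ℕ.* d) · 1# ≈ (a · 1#) * (c · 1#) + (b · 1#) * (d · 1#)
  ×1-homo-+* a b c d =
    trans (×-homo-+ 1# (a ℕ.* c) (b ℕ.* d)) (+-cong (×1-homo-* a c) (×1-homo-* b d))

  homomorphism : ℕ²-rawRing -Raw-AlmostCommutative⟶ fromCommutativeRing R
  homomorphism = record
    { ⟦_⟧    = ⟦_⟧ℕ²
    ; +-homo = λ (a , b) (c , d) →
        trans (+-cong (×-homo-+ 1# a c) (-‿cong (×-homo-+ 1# b d))) (x+z-[y+w]≈[x-y]+[z-w] _ _ _ _)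
    ; *-homo = λ (a , b) (c , d) →
        trans (+-cong (×1-homo-+* a b c d) (-‿cong (×1-homo-+* a b d c)))
              (sym ([x-y][z-w]≈[xz+yw]-[xw+yz] _ _ _ _))
    ; -‿homo = λ (a , b) → sym (⁻¹-anti-homo‿- (a · 1#) (b · 1#))
    ; 0-homo = -‿inverseʳ 0#
    ; 1-homo = trans (+-cong (×-homo-1 1#) -0#≈0#) (+-identityʳ 1#)
    }

  _≟_ : WeaklyDecidable (Induced-equivalence homomorphism)
  (a , b) ≟ (c , d) with a ℕ.+ d ℕ.≟ b ℕ.+ c
  ... | no _          = nothing
  ... | yes a+d≡b+c = just (x+w≈y+z⇒x-y≈z-w (begin
    a · 1# + d · 1# ≈⟨ ×-homo-+ 1# a d ⟨
    (a ℕ.+ d) · 1#  ≡⟨ cong (_· 1#) a+d≡b+c ⟩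
    (b ℕ.+ c) · 1#  ≈⟨ ×-homo-+ 1# b c ⟩
    b · 1# + c · 1# ∎))

  open import Algebra.Solver.Ring ℕ²-rawRing (fromCommutativeRing R) homomorphism _≟_ public

module _ {c ℓ : Level} (K : Field c ℓ) where
  open Field K
  open import Algebra.Properties.Ring ring using (-0#≈0#; -‿involutive; -‿distribˡ-*)
  open import Algebra.Properties.AbelianGroup +-abelianGroup using (inverseˡ-unique)
  open import Relation.Binary.Reasoning.Setoid setoid
  open RingSolver commutativeRing using (solve; _:+_; _:*_; _:-_; :-_; _:=_; con)

  WedgeDecomposition : Series2 K → Set (c ⊔ ℓ)
  WedgeDecomposition f =
    ∃ λ (m₀ : ℤ) → ∃ λ (k₀ : ℤ) → ∃ λ (p : Series1 K) → ∃ λ (q : Series1 K) →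
      Σ (¬ (q m₀ ≈ 0#)) λ qm₀≢0 →
        (p m₀ ≈ 0#) × (q k₀ ≈ 0#) × (p k₀ ≈ - q m₀) ×
        (∀ i j → f i j ≈ wedge K p (scale K (inv (q m₀) qm₀≢0) q) i j)

  x*y≈0⇒x≈0 : ∀ {x y} → ¬ y ≈ 0# → x * y ≈ 0# → x ≈ 0#
  x*y≈0⇒x≈0 {x} {y} y≉0 x*y≈0 = begin
    x                   ≈⟨ *-identityʳ x ⟨
    x * 1#              ≈⟨ *-congˡ (proj₂ (inverse y y≉0)) ⟨
    x * (y * inv y y≉0) ≈⟨ *-assoc x y (inv y y≉0) ⟨
    (x * y) * inv y y≉0 ≈⟨ *-congʳ x*y≈0 ⟩
    0# * inv y y≉0      ≈⟨ zeroˡ (inv y y≉0) ⟩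
    0#                  ∎

  selfOrthogonal-resp-≈ : ∀ {f g : Series2 K} → (∀ i j → f i j ≈ g i j) →
                          SelfOrthogonal K g → SelfOrthogonal K f
  selfOrthogonal-resp-≈ f≈g g⊥g m i j k = trans
    (+-cong (+-cong (*-cong (f≈g m i) (f≈g k j)) (-‿cong (*-cong (f≈g k i) (f≈g m j))))
            (*-cong (f≈g k m) (f≈g i j)))
    (g⊥g m i j k)

  wedge-selfOrthogonal : ∀ P Q → SelfOrthogonal K (wedge K P Q)
  -- The solver reads the constant (0 , 0) as 0# - 0#, hence the final step.
  wedge-selfOrthogonal P Q m i j k = trans
    (solve 8 (λ pm pi pj pk qm qi qj qk →
        ((pm :* qi :- pi :* qm) :* (pk :* qj :- pj :* qk)
          :- (pk :* qi :- pi :* qk) :* (pm :* qj :- pj :* qm))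
          :+ (pk :* qm :- pm :* qk) :* (pi :* qj :- pj :* qi)
        := con (0 , 0))
      refl (P m) (P i) (P j) (P k) (Q m) (Q i) (Q j) (Q k))
    (-‿inverseʳ 0#)

  wedge-neg-scale : ∀ P Q e i j →
    wedge K (λ n → - P n) (scale K e (λ n → - Q n)) i j ≈ e * wedge K P Q i j
  wedge-neg-scale P Q e i j =
    solve 5 (λ pi pj qi qj e →
        (:- pi) :* (e :* (:- qj)) :- (:- pj) :* (e :* (:- qi)) := e :* (pi :* qj :- pj :* qi))
      refl (P i) (P j) (Q i) (Q j) e

  module _ {f : Series2 K} (f⊥f : SelfOrthogonal K f) where

    selfOrthogonal⇒diagonal*≈0 : ∀ m i j → f m m * f i j ≈ 0#
    selfOrthogonal⇒diagonal*≈0 m i j = begin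
      f m m * f i j                                   ≈⟨ +-identityˡ _ ⟨
      0# + f m m * f i j                              ≈⟨ +-congʳ (-‿inverseʳ (f m i * f m j)) ⟨
      (f m i * f m j - f m i * f m j) + f m m * f i j ≈⟨ f⊥f m i j m ⟩
      0#                                              ∎

    selfOrthogonal⇒antisymmetric* : ∀ a b → (f b a + f a b) * f a b ≈ 0#
    selfOrthogonal⇒antisymmetric* a b = begin
      (f b a + f a b) * f a b                         ≈⟨ distribʳ (f a b) (f b a) (f a b) ⟩
      f b a * f a b + f a b * f a b                   ≈⟨ +-congʳ (+-identityʳ _) ⟨
      (f b a * f a b + 0#) + f a b * f a b            ≈⟨ +-congʳ (+-congˡ -0#≈0#) ⟨
      (f b a * f a b - 0#) + f a b * f a b            ≈⟨ +-congʳ (+-congˡ (-‿cong faa*fbb≈0)) ⟨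
      (f b a * f a b - f a a * f b b) + f a b * f a b ≈⟨ f⊥f b a b a ⟩
      0#                                              ∎
      where
      faa*fbb≈0 : f a a * f b b ≈ 0#
      faa*fbb≈0 = selfOrthogonal⇒diagonal*≈0 a b b

    selfOrthogonal⇒wedge-rows : ∀ a b i j → wedge K (f a) (f b) i j ≈ - f b a * f i j
    selfOrthogonal⇒wedge-rows a b i j = begin
      f a i * f b j - f a j * f b i ≈⟨ +-congˡ (-‿cong (*-comm (f a j) (f b i))) ⟩
      f a i * f b j - f b i * f a j ≈⟨ inverseˡ-unique _ _ (f⊥f a i j b) ⟩
      - (f b a * f i j)             ≈⟨ -‿distribˡ-* (f b a) (f i j) ⟩
      - f b a * f i j               ∎

    selfOrthogonal⇒wedgeDecomposition : ∀ {a b} → ¬ f a b ≈ 0# → WedgeDecomposition f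
    selfOrthogonal⇒wedgeDecomposition {a} {b} fab≉0 =
      a , b , p , q , qa≉0 , -‿zero (fmm≈0 a) , -‿zero (fmm≈0 b) , -‿cong (sym qa≈fab) , f≈wedge
      where
      p q : Series1 K
      p n = - f a n
      q n = - f b n

      -‿zero : ∀ {x} → x ≈ 0# → - x ≈ 0#
      -‿zero x≈0 = trans (-‿cong x≈0) -0#≈0#

      fmm≈0 : ∀ m → f m m ≈ 0#
      fmm≈0 m = x*y≈0⇒x≈0 fab≉0 (selfOrthogonal⇒diagonal*≈0 m a b)

      fba+fab≈0 : f b a + f a b ≈ 0#
      fba+fab≈0 = x*y≈0⇒x≈0 fab≉0 (selfOrthogonal⇒antisymmetric* a b)

      qa≈fab : q a ≈ f a b
      qa≈fab = begin
        - f b a   ≈⟨ -‿cong (inverseˡ-unique _ _ fba+fab≈0) ⟩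
        - - f a b ≈⟨ -‿involutive (f a b) ⟩
        f a b     ∎

      qa≉0 : ¬ q a ≈ 0#
      qa≉0 qa≈0 = fab≉0 (trans (sym qa≈fab) qa≈0)

      e : Carrier
      e = inv (q a) qa≉0

      e*qa≈1 : e * q a ≈ 1#
      e*qa≈1 = trans (*-comm e (q a)) (proj₂ (inverse (q a) qa≉0))

      f≈wedge : ∀ i j → f i j ≈ wedge K p (scale K e q) i j
      f≈wedge i j = begin
        f i j                        ≈⟨ *-identityˡ (f i j) ⟨
        1# * f i j                   ≈⟨ *-congʳ e*qa≈1 ⟨
        (e * q a) * f i j            ≈⟨ *-assoc e (q a) (f i j) ⟩
        e * (q a * f i j)            ≈⟨ *-congˡ (selfOrthogonal⇒wedge-rows a b i j) ⟨
        e * wedge K (f a) (f b) i j  ≈⟨ wedge-neg-scale (f a) (f b) e i j ⟨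
        wedge K p (scale K e q) i j  ∎

  wedgeDecomposition⇒selfOrthogonal : ∀ {f} → WedgeDecomposition f → SelfOrthogonal K f
  wedgeDecomposition⇒selfOrthogonal (_ , _ , p , _ , _ , _ , _ , _ , f≈wedge) =
    selfOrthogonal-resp-≈ f≈wedge (wedge-selfOrthogonal p _)

theorem2p1 : {c ℓ : Level} (K : Field c ℓ) → let open Field K in
    (f : Series2 K) → NonzeroSeries K f →
    (SelfOrthogonal K f ⇔
      (∃ λ (m₀ : ℤ) → ∃ λ (k₀ : ℤ) → ∃ λ (p : Series1 K) → ∃ λ (q : Series1 K) →
        Σ (¬ (q m₀ ≈ 0#)) λ qm₀≢0 →
          (p m₀ ≈ 0#) × (q k₀ ≈ 0#) × (p k₀ ≈ - q m₀) ×
          (∀ i j → f i j ≈ wedge K p (scale K (inv (q m₀) qm₀≢0) q) i j)))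
theorem2p1 K f (_ , _ , fab≉0) = mk⇔
  (λ f⊥f → selfOrthogonal⇒wedgeDecomposition K f⊥f fab≉0)
  (wedgeDecomposition⇒selfOrthogonal K)
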